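{- Let $0<c_1,c_2<1$ and $\eta>0$ be constants and let $m$ be a positive integer. Let $H$ be a $4$-graph whose vertex set is the disjoint union of sets $A$, $B$, $Z$ with $|A|=|B| = c_1 m$ and $|Z| = c_2 2^{m^3}$, such that every edge of $H$ contains exactly one vertex of $A$, one vertex of $B$ and two vertices of $Z$. If $$d_4\left(A,B,\binom{Z}{2}\right) \geq 2\eta,$$ then there exist $A'\subset A$, $B'\subset B$ and disjoint $Z_1,Z_2 \subset Z$ with $|A'|=|B'|=|Z_1|=|Z_2| = c\log m$, for a constant $c = c(c_1,c_2,\eta)$, such that every $4$-set $\{a,b,z_1,z_2\}$ with $a\in A'$, $b\in B'$, $z_1\in Z_1$, $z_2\in Z_2$ is an edge of $H$.
   Context: A $4$-graph is a pair consisting of a vertex set and a family of $4$-element subsets (edges). Here $d_4\left(A,B,\binom{Z}{2}\right) = |E(H)| / \left(|A||B|\binom{|Z|}{2}\right)$. Logarithms are base $2$.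
   Formalization: The constant η ranges over the positive rationals. -}

module Defs where

open import Data.Nat using (ℕ; zero; suc; _+_; _*_; _<ᵇ_)
open import Data.Bool using (Bool; true; false; if_then_else_; _∧_)
open import Data.Fin using (Fin; toℕ; zero; suc)
open import Data.Integer using (+_)
open import Data.Rational using (ℚ; _/_)

ℕtoℚ : ℕ → ℚ
ℕtoℚ n = + n / 1

sumFin : (n : ℕ) → (Fin n → ℕ) → ℕ
sumFin zero    f = 0
sumFin (suc n) f = f zero + sumFin n (λ i → f (suc i))

-- A 4-graph on the disjoint union A ⊔ B ⊔ Z (A = Fin a, B = Fin b, Z = Fin z)
-- all of whose edges meet A, B in one vertex each and Z in two vertices is
-- given by E x y i j = true iff {x, y, i, j} is an edge (E symmetric in i j,
-- and E x y i i = false).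
edgeCount : (a b z : ℕ) → (Fin a → Fin b → Fin z → Fin z → Bool) → ℕ
edgeCount a b z E =
  sumFin a λ x → sumFin b λ y → sumFin z λ i → sumFin z λ j →
    if (toℕ i <ᵇ toℕ j) ∧ E x y i j then 1 else 0

module Submission where

-- A deterministic Kővári–Sós–Turán (dependent random choice) argument,
-- applied three times.
--
-- The key tool is the biclique lemma `commonNeighbourhood`: if U has average
-- degree ≥ v/ρ into Fin v and 4ρt ≤ v, some t-set T ⊆ Fin v has
-- ≥ |U| / (2ρ(8ρ)^t) common neighbours.  A 1/(2ρ) fraction of U has degree
-- ≥ k = ⌊v/2ρ⌋ (`manyLarge`); among those, the greedy construction (`Greedy`)
-- repeatedly adds to T the vertex adjacent to most survivors.
--
-- `completeSubgraph` views H as a bipartite graph between A and triples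
-- (y, i, j), giving A′ and many common triples; these form a dense graph
-- between B and pairs (i, j), giving B′; the surviving pairs form a dense
-- graph on Z, giving Z₂ and ≥ t common neighbours, among which Z₁ is chosen.
-- Z₁ ∩ Z₂ = ∅ as H has no edge {x, y, i, i}.  The losses are 2^{poly(t)}, which
-- |A|, |B| ≥ c₁m and |Z| ≥ c₂2^{m³} afford once 2^{tq} ≤ m (`theoremℕ`).

open import Defs
open import Data.Nat using (ℕ; _^_; _≤_; _<_; _*_)
open import Data.Nat.Combinatorics using (_C_)
open import Data.Bool using (Bool; true; false)
open import Data.Fin using (Fin)
open import Data.Fin.Subset using (Subset; _∈_; _∉_; ∣_∣)
open import Data.Product using (Σ; _×_; ∃-syntax)
open import Relation.Binary.PropositionalEquality using (_≡_)
open import Data.Rational using (ℚ; 0ℚ; 1ℚ) renaming (_*_ to _*ℚ_; _<_ to _<ℚ_; _≤_ to _≤ℚ_)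

open import Data.Nat
open import Data.Nat.Properties
open import Data.Nat.DivMod using (m/n*n≤m; m≡m%n+[m/n]*n; m%n<n)
open import Data.Nat.Tactic.RingSolver using (solve-∀)
open import Data.Nat.Combinatorics using (nCk+nC[k+1]≡[n+1]C[k+1]; nC1≡n)
open import Data.Bool using (not; _∧_; _∨_; if_then_else_)
open import Data.Bool.Properties using (T-≡; ∨-identityʳ; ∧-conicalˡ; ∧-conicalʳ)
open import Function.Bundles using (Equivalence)
open import Data.Fin using (zero; suc)
open import Data.Product using (_,_; proj₁; proj₂)
open import Data.Vec using (tabulate)
open import Data.Vec.Properties using ([]=⇒lookup; lookup∘tabulate)
open import Relation.Nullary using (yes; no)
open import Data.Empty using (⊥)
open import Relation.Binary.PropositionalEquality using (refl; sym; trans; cong; cong₂; subst; subst₂)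
open import Data.Rational as Q using (mkℚ)
import Data.Rational.Properties as QP
import Data.Rational.Unnormalised as Qᵘ
import Data.Rational.Unnormalised.Properties as QᵘP
import Data.Integer as Z
import Data.Integer.Properties as ZP

ℕtoℚ≃ : ∀ n → Q.toℚᵘ (ℕtoℚ n) Qᵘ.≃ Qᵘ.mkℚᵘ (Z.+ n) 0
ℕtoℚ≃ n = QP.toℚᵘ-fromℚᵘ (Qᵘ.mkℚᵘ (Z.+ n) 0)

ℕtoℚ-* : ∀ x y → ℕtoℚ (x * y) ≡ ℕtoℚ x *ℚ ℕtoℚ y
ℕtoℚ-* x y = QP.toℚᵘ-injective (begin
  Q.toℚᵘ (ℕtoℚ (x * y))                    ≈⟨ ℕtoℚ≃ (x * y) ⟩
  Qᵘ.mkℚᵘ (Z.+ (x * y)) 0                  ≈⟨ Qᵘ.*≡* (cong (Z._* Z.+ 1) (ZP.pos-* x y)) ⟩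
  Qᵘ.mkℚᵘ (Z.+ x) 0 Qᵘ.* Qᵘ.mkℚᵘ (Z.+ y) 0 ≈⟨ QᵘP.*-cong (ℕtoℚ≃ x) (ℕtoℚ≃ y) ⟨
  Q.toℚᵘ (ℕtoℚ x) Qᵘ.* Q.toℚᵘ (ℕtoℚ y)    ≈⟨ QP.toℚᵘ-homo-* (ℕtoℚ x) (ℕtoℚ y) ⟨
  Q.toℚᵘ (ℕtoℚ x *ℚ ℕtoℚ y)                ∎)
  where open QᵘP.≃-Reasoning

ℕtoℚ-cancel-≤ : ∀ x y → ℕtoℚ x ≤ℚ ℕtoℚ y → x ≤ y
ℕtoℚ-cancel-≤ x y x≤y with QᵘP.≤-respʳ-≃ (ℕtoℚ≃ y) (QᵘP.≤-respˡ-≃ (ℕtoℚ≃ x) (QP.toℚᵘ-mono-≤ x≤y))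
... | Qᵘ.*≤* x*1≤y*1 = ZP.drop‿+≤+ (subst₂ Z._≤_ (ZP.*-identityʳ (Z.+ x)) (ZP.*-identityʳ (Z.+ y)) x*1≤y*1)

ℕtoℚ-injective : ∀ x y → ℕtoℚ x ≡ ℕtoℚ y → x ≡ y
ℕtoℚ-injective x y x≡y =
  ≤-antisym (ℕtoℚ-cancel-≤ x y (QP.≤-reflexive x≡y)) (ℕtoℚ-cancel-≤ y x (QP.≤-reflexive (sym x≡y)))

ℕtoℚ-nonNeg : ∀ n → 0ℚ ≤ℚ ℕtoℚ n
ℕtoℚ-nonNeg n = QP.toℚᵘ-cancel-≤ (QᵘP.≤-respʳ-≃ (QᵘP.≃-sym (ℕtoℚ≃ n))
  (Qᵘ.*≤* (subst (Z._≤_ (Z.+ 0)) (sym (ZP.*-identityʳ (Z.+ n))) (Z.+≤+ z≤n))))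

record Cleared (q : ℚ) : Set where
  field
    num den : ℕ
    cleared : ℕtoℚ (suc den) *ℚ q ≡ ℕtoℚ (suc num)

clearDenominator : ∀ q → 0ℚ <ℚ q → Cleared q
clearDenominator (mkℚ (Z.+[1+ k ]) d _) _ = record { num = k ; den = d ; cleared = QP.toℚᵘ-injective (begin
  Q.toℚᵘ (ℕtoℚ (suc d) *ℚ mkℚ Z.+[1+ k ] d _)      ≈⟨ QP.toℚᵘ-homo-* (ℕtoℚ (suc d)) _ ⟩
  Q.toℚᵘ (ℕtoℚ (suc d)) Qᵘ.* Qᵘ.mkℚᵘ Z.+[1+ k ] d ≈⟨ QᵘP.*-cong (ℕtoℚ≃ (suc d)) (QᵘP.≃-refl {Qᵘ.mkℚᵘ Z.+[1+ k ] d}) ⟩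
  Qᵘ.mkℚᵘ (Z.+ suc d) 0 Qᵘ.* Qᵘ.mkℚᵘ Z.+[1+ k ] d ≈⟨ Qᵘ.*≡* crossMultiplied ⟩
  Qᵘ.mkℚᵘ (Z.+ suc k) 0                             ≈⟨ ℕtoℚ≃ (suc k) ⟨
  Q.toℚᵘ (ℕtoℚ (suc k))                             ∎) }
  where
  open QᵘP.≃-Reasoning
  rearrange : ∀ d k → suc d * suc k * 1 ≡ suc k * suc (d + 0 * suc d)
  rearrange = solve-∀
  crossMultiplied : Z.+ suc d Z.* Z.+[1+ k ] Z.* Z.+ 1 ≡ Z.+ suc k Z.* Z.+ suc (d + 0 * suc d)
  crossMultiplied = trans (cong (Z._* Z.+ 1) (sym (ZP.pos-* (suc d) (suc k))))
    (trans (sym (ZP.pos-* (suc d * suc k) 1)) (trans (cong Z.+_ (rearrange d k)) (ZP.pos-* (suc k) _)))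
clearDenominator (mkℚ (Z.+ zero) d _) (Q.*<* (Z.+<+ ()))
clearDenominator (mkℚ Z.-[1+ n ] d _) (Q.*<* ())

ratioBound : ∀ {c} (C : Cleared c) x y → ℕtoℚ x ≡ c *ℚ ℕtoℚ y → y ≤ suc (Cleared.den C) * x
ratioBound {c} C x y x≡cy = ≤-trans (m≤n*m y (suc num)) (≤-reflexive (sym (ℕtoℚ-injective _ _ (begin-equality
  ℕtoℚ (suc den * x)                    ≡⟨ ℕtoℚ-* (suc den) x ⟩
  ℕtoℚ (suc den) *ℚ ℕtoℚ x              ≡⟨ cong (ℕtoℚ (suc den) *ℚ_) x≡cy ⟩
  ℕtoℚ (suc den) *ℚ (c *ℚ ℕtoℚ y)       ≡⟨ QP.*-assoc (ℕtoℚ (suc den)) c (ℕtoℚ y) ⟨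
  ℕtoℚ (suc den) *ℚ c *ℚ ℕtoℚ y         ≡⟨ cong (_*ℚ ℕtoℚ y) cleared ⟩
  ℕtoℚ (suc num) *ℚ ℕtoℚ y              ≡⟨ ℕtoℚ-* (suc num) y ⟨
  ℕtoℚ (suc num * y)                    ∎))))
  where
  open Cleared C
  open QP.≤-Reasoning

densityBound : ∀ {η} (C : Cleared η) X e → (ℕtoℚ 2 *ℚ η) *ℚ ℕtoℚ X ≤ℚ ℕtoℚ e → 2 * X ≤ suc (Cleared.den C) * e
densityBound {η} C X e 2ηX≤e = ≤-trans (*-monoˡ-≤ X (*-monoʳ-≤ 2 (s≤s (z≤n {num}))))
  (ℕtoℚ-cancel-≤ _ _ (begin
    ℕtoℚ (2 * suc num * X)                   ≡⟨ ℕtoℚ-* (2 * suc num) X ⟩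
    ℕtoℚ (2 * suc num) *ℚ ℕtoℚ X             ≡⟨ cong (_*ℚ ℕtoℚ X) twice ⟨
    D *ℚ (ℕtoℚ 2 *ℚ η) *ℚ ℕtoℚ X             ≡⟨ QP.*-assoc D _ _ ⟩
    D *ℚ ((ℕtoℚ 2 *ℚ η) *ℚ ℕtoℚ X)           ≤⟨ QP.*-monoˡ-≤-nonNeg D {{Q.nonNegative (ℕtoℚ-nonNeg (suc den))}} 2ηX≤e ⟩
    D *ℚ ℕtoℚ e                              ≡⟨ ℕtoℚ-* (suc den) e ⟨
    ℕtoℚ (suc den * e)                       ∎))
  where
  open Cleared C
  open QP.≤-Reasoning
  D = ℕtoℚ (suc den)
  twice : D *ℚ (ℕtoℚ 2 *ℚ η) ≡ ℕtoℚ (2 * suc num)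
  twice = begin-equality
    D *ℚ (ℕtoℚ 2 *ℚ η)  ≡⟨ QP.*-assoc D (ℕtoℚ 2) η ⟨
    D *ℚ ℕtoℚ 2 *ℚ η    ≡⟨ cong (_*ℚ η) (QP.*-comm D (ℕtoℚ 2)) ⟩
    ℕtoℚ 2 *ℚ D *ℚ η    ≡⟨ QP.*-assoc (ℕtoℚ 2) D η ⟩
    ℕtoℚ 2 *ℚ (D *ℚ η)  ≡⟨ cong (ℕtoℚ 2 *ℚ_) cleared ⟩
    ℕtoℚ 2 *ℚ ℕtoℚ (suc num) ≡⟨ ℕtoℚ-* 2 (suc num) ⟨
    ℕtoℚ (2 * suc num)  ∎

open ≤-Reasoning

⟦_⟧ : Bool → ℕ
⟦ true ⟧  = 1
⟦ false ⟧ = 0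

⟦⟧≤1 : ∀ b → ⟦ b ⟧ ≤ 1
⟦⟧≤1 true  = ≤-refl
⟦⟧≤1 false = z≤n

-- Finite sums over Fin n and iterated sums over products are instances; this
-- lets one counting lemma speak about vertices, pairs and triples alike.
record Summation (U : Set) : Set where
  field
    card      : ℕ
    sum       : (U → ℕ) → ℕ
    sum-+     : ∀ f g → sum (λ u → f u + g u) ≡ sum f + sum g
    sum-mono  : ∀ f g → (∀ u → f u ≤ g u) → sum f ≤ sum g
    sum-*ʳ    : ∀ f c → sum (λ u → f u * c) ≡ sum f * c
    sum-const : ∀ c → sum (λ _ → c) ≡ c * card

open Summation

count : ∀ {U} → Summation U → (U → Bool) → ℕ
count E P = sum E (λ u → ⟦ P u ⟧)

sum-cong : ∀ {U} (E : Summation U) f g → (∀ u → f u ≡ g u) → sum E f ≡ sum E g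
sum-cong E f g f≡g =
  ≤-antisym (sum-mono E f g (λ u → ≤-reflexive (f≡g u)))
            (sum-mono E g f (λ u → ≤-reflexive (sym (f≡g u))))

sum-*ˡ : ∀ {U} (E : Summation U) c f → sum E (λ u → c * f u) ≡ c * sum E f
sum-*ˡ E c f = begin-equality
  sum E (λ u → c * f u) ≡⟨ sum-cong E _ _ (λ u → *-comm c (f u)) ⟩
  sum E (λ u → f u * c) ≡⟨ sum-*ʳ E f c ⟩
  sum E f * c           ≡⟨ *-comm _ c ⟩
  c * sum E f           ∎

sumFin-+ : ∀ n (f g : Fin n → ℕ) → sumFin n (λ i → f i + g i) ≡ sumFin n f + sumFin n g
sumFin-+ zero    f g = refl
sumFin-+ (suc n) f g = begin-equality
  (f zero + g zero) + sumFin n (λ i → f (suc i) + g (suc i))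
    ≡⟨ cong (f zero + g zero +_) (sumFin-+ n (λ i → f (suc i)) (λ i → g (suc i))) ⟩
  (f zero + g zero) + (sumFin n (λ i → f (suc i)) + sumFin n (λ i → g (suc i)))
    ≡⟨ +-+-interchange (f zero) _ _ _ ⟩
  (f zero + sumFin n (λ i → f (suc i))) + (g zero + sumFin n (λ i → g (suc i))) ∎
  where
  +-+-interchange : ∀ a b c d → (a + b) + (c + d) ≡ (a + c) + (b + d)
  +-+-interchange = solve-∀

sumFin-mono : ∀ n (f g : Fin n → ℕ) → (∀ i → f i ≤ g i) → sumFin n f ≤ sumFin n g
sumFin-mono zero    f g f≤g = z≤n
sumFin-mono (suc n) f g f≤g = +-mono-≤ (f≤g zero) (sumFin-mono n _ _ (λ i → f≤g (suc i)))

sumFin-*ʳ : ∀ n (f : Fin n → ℕ) c → sumFin n (λ i → f i * c) ≡ sumFin n f * c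
sumFin-*ʳ zero    f c = refl
sumFin-*ʳ (suc n) f c =
  trans (cong (f zero * c +_) (sumFin-*ʳ n (λ i → f (suc i)) c)) (sym (*-distribʳ-+ c (f zero) _))

sumFin-const : ∀ n c → sumFin n (λ _ → c) ≡ c * n
sumFin-const zero    c = sym (*-zeroʳ c)
sumFin-const (suc n) c = trans (cong (c +_) (sumFin-const n c)) (sym (*-suc c n))

finSum : (n : ℕ) → Summation (Fin n)
finSum n = record
  { card = n ; sum = sumFin n ; sum-+ = sumFin-+ n ; sum-mono = sumFin-mono n
  ; sum-*ʳ = sumFin-*ʳ n ; sum-const = sumFin-const n }

_⊗_ : ∀ {U W} → Summation U → Summation W → Summation (U × W)
_⊗_ {U} {W} E F = record
  { card = card E * card F ; sum = iterated ; sum-+ = iterated-+ ; sum-mono = iterated-mono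
  ; sum-*ʳ = iterated-*ʳ ; sum-const = iterated-const }
  where
  iterated : (U × W → ℕ) → ℕ
  iterated f = sum E (λ u → sum F (λ w → f (u , w)))
  iterated-+ : ∀ f g → iterated (λ p → f p + g p) ≡ iterated f + iterated g
  iterated-+ f g = trans (sum-cong E _ _ (λ u → sum-+ F _ _)) (sum-+ E _ _)
  iterated-mono : ∀ f g → (∀ p → f p ≤ g p) → iterated f ≤ iterated g
  iterated-mono f g f≤g = sum-mono E _ _ (λ u → sum-mono F _ _ (λ w → f≤g (u , w)))
  iterated-*ʳ : ∀ f c → iterated (λ p → f p * c) ≡ iterated f * c
  iterated-*ʳ f c = trans (sum-cong E _ _ (λ u → sum-*ʳ F _ c)) (sum-*ʳ E _ c)
  iterated-const : ∀ c → iterated (λ _ → c) ≡ c * (card E * card F)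
  iterated-const c = begin-equality
    sum E (λ _ → sum F (λ _ → c)) ≡⟨ sum-cong E _ _ (λ _ → sum-const F c) ⟩
    sum E (λ _ → c * card F)      ≡⟨ sum-const E (c * card F) ⟩
    c * card F * card E           ≡⟨ *-assoc c _ _ ⟩
    c * (card F * card E)         ≡⟨ cong (c *_) (*-comm (card F) (card E)) ⟩
    c * (card E * card F)         ∎

sum-swap : ∀ {U} (E : Summation U) v (f : U → Fin v → ℕ) →
  sum E (λ u → sumFin v (f u)) ≡ sumFin v (λ w → sum E (λ u → f u w))
sum-swap E zero    f = sum-const E 0
sum-swap E (suc v) f =
  trans (sum-+ E _ _) (cong (sum E (λ u → f u zero) +_) (sum-swap E v (λ u w → f u (suc w))))

size : ∀ {n} → (Fin n → Bool) → ℕ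
size {n} P = count (finSum n) P

size≤ : ∀ n (P : Fin n → Bool) → size P ≤ n
size≤ n P = begin
  size P              ≤⟨ sumFin-mono n _ _ (λ i → ⟦⟧≤1 (P i)) ⟩
  sumFin n (λ _ → 1)  ≡⟨ sumFin-const n 1 ⟩
  1 * n               ≡⟨ *-identityˡ n ⟩
  n                   ∎

nonMember : ∀ n (P : Fin n → Bool) → size P < n → Σ (Fin n) λ w → P w ≡ false
nonMember (suc n) P small with P zero in P0
... | false = zero , P0
... | true with nonMember n (λ i → P (suc i)) (s≤s⁻¹ small)
...   | w , Pw = suc w , Pw

member : ∀ n (P : Fin n → Bool) → 1 ≤ size P → Σ (Fin n) λ w → P w ≡ true
member (suc n) P nonempty with P zero in P0
... | true = zero , P0
... | false with member n (λ i → P (suc i)) nonempty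
...   | w , Pw = suc w , Pw

_==_ : ∀ {n} → Fin n → Fin n → Bool
zero  == zero  = true
zero  == suc _ = false
suc _ == zero  = false
suc x == suc y = x == y

==-sound : ∀ {n} (x y : Fin n) → (x == y) ≡ true → x ≡ y
==-sound zero    zero    _    = refl
==-sound (suc x) (suc y) x==y = cong suc (==-sound x y x==y)

size-insert : ∀ n (P : Fin n → Bool) w → P w ≡ false →
  size (λ x → P x ∨ (x == w)) ≡ suc (size P)
size-insert (suc n) P zero Pw rewrite Pw =
  cong suc (sum-cong (finSum n) _ _ (λ i → cong ⟦_⟧ (∨-identityʳ (P (suc i)))))
size-insert (suc n) P (suc w) Pw rewrite ∨-identityʳ (P zero) | size-insert n (λ i → P (suc i)) w Pw =
  +-suc _ _

argmax : ∀ n (f : Fin (suc n) → ℕ) → Σ (Fin (suc n)) λ x → ∀ y → f y ≤ f x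
argmax zero    f = zero , λ { zero → ≤-refl }
argmax (suc n) f with argmax n (λ i → f (suc i))
... | x , x-max with f zero ≤? f (suc x)
...   | yes f0≤ = suc x , λ { zero → f0≤ ; (suc y) → x-max y }
...   | no  f0≰ = zero , λ { zero → ≤-refl ; (suc y) → ≤-trans (x-max y) (<⇒≤ (≰⇒> f0≰)) }

bestOutside : ∀ n (P : Fin n → Bool) (f : Fin n → ℕ) → Σ (Fin n) (λ w → P w ≡ false) →
  Σ (Fin n) λ w → P w ≡ false × sumFin n (λ x → ⟦ not (P x) ⟧ * f x) ≤ n * f w
bestOutside (suc n) P f (w₀ , Pw₀) with argmax n (λ x → ⟦ not (P x) ⟧ * f x)
... | x , x-max with P x in Px
...   | false = x , Px , (begin
        sumFin (suc n) (λ y → ⟦ not (P y) ⟧ * f y) ≤⟨ sumFin-mono (suc n) _ _ (λ y → x-max y) ⟩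
        sumFin (suc n) (λ _ → f x + 0)             ≡⟨ sumFin-const (suc n) _ ⟩
        (f x + 0) * suc n                          ≡⟨ cong (_* suc n) (+-identityʳ (f x)) ⟩
        f x * suc n                                ≡⟨ *-comm (f x) (suc n) ⟩
        suc n * f x                                ∎)
...   | true = w₀ , Pw₀ , (begin
        sumFin (suc n) (λ y → ⟦ not (P y) ⟧ * f y) ≤⟨ sumFin-mono (suc n) _ _ (λ y → x-max y) ⟩
        sumFin (suc n) (λ _ → 0)                   ≡⟨ sumFin-const (suc n) 0 ⟩
        0                                          ≤⟨ z≤n ⟩
        suc n * f w₀                               ∎)

size-split : ∀ n (P Q : Fin n → Bool) → size Q ≤ sumFin n (λ x → ⟦ not (P x) ⟧ * ⟦ Q x ⟧) + size P
size-split n P Q = ≤-trans (sumFin-mono n _ _ pointwise) (≤-reflexive (sumFin-+ n _ _))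
  where
  pointwise : ∀ i → ⟦ Q i ⟧ ≤ ⟦ not (P i) ⟧ * ⟦ Q i ⟧ + ⟦ P i ⟧
  pointwise i with P i | Q i
  ... | true  | true  = s≤s z≤n
  ... | true  | false = z≤n
  ... | false | true  = ≤-refl
  ... | false | false = z≤n

choose : ∀ n (P : Fin n → Bool) t → t ≤ size P →
  Σ (Fin n → Bool) λ S → size S ≡ t × (∀ i → S i ≡ true → P i ≡ true)
choose n P zero _ = (λ _ → false) , sumFin-const n 0 , λ i ()
choose (suc n) P (suc t) t<P with P zero in P0
... | true with choose n (λ i → P (suc i)) t (s≤s⁻¹ t<P)
...   | S , |S| , S⊆P = (λ { zero → true ; (suc i) → S i }) , cong suc |S| ,
                        λ { zero _ → P0 ; (suc i) Si → S⊆P i Si }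
choose (suc n) P (suc t) t<P | false with choose n (λ i → P (suc i)) (suc t) t<P
...   | S , |S| , S⊆P = (λ { zero → false ; (suc i) → S i }) , |S| ,
                        λ { zero () ; (suc i) Si → S⊆P i Si }

toSubset : ∀ {n} → (Fin n → Bool) → Subset n
toSubset = tabulate

∣toSubset∣ : ∀ n (P : Fin n → Bool) → ∣ toSubset P ∣ ≡ size P
∣toSubset∣ zero    P = refl
∣toSubset∣ (suc n) P with P zero
... | true  = cong suc (∣toSubset∣ n (λ i → P (suc i)))
... | false = ∣toSubset∣ n (λ i → P (suc i))

∈-toSubset : ∀ {n} (P : Fin n → Bool) i → i ∈ toSubset P → P i ≡ true
∈-toSubset P i i∈P = trans (sym (lookup∘tabulate P i)) ([]=⇒lookup i∈P)

record Biclique {U : Set} (E : Summation U) (v : ℕ) (R : U → Fin v → Bool) (t B : ℕ) : Set where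
  field
    tips      : Fin v → Bool
    base      : U → Bool
    tips-size : size tips ≡ t
    complete  : ∀ u w → base u ≡ true → tips w ≡ true → R u w ≡ true
    large     : card E ≤ B * count E base

weaken : ∀ {U} {E : Summation U} {v R t B B′} → B ≤ B′ → Biclique E v R t B → Biclique E v R t B′
weaken {E = E} B≤B′ K = record
  { tips = tips ; base = base ; tips-size = tips-size ; complete = complete
  ; large = ≤-trans large (*-monoˡ-≤ (count E base) B≤B′) }
  where open Biclique K

-- Grow T one vertex at a time,
-- always adding the w ∉ T adjacent to most surviving u and keeping only
-- those.  A survivor has ≥ k − t neighbours outside T, so by averaging the
-- survivors shrink at most by the factor (k − t)/v per step.
module Greedy {U : Set} (E : Summation U) (v : ℕ) (R : U → Fin v → Bool) (k t : ℕ) (t≤v : t ≤ v) where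

  deg : U → ℕ
  deg u = size (R u)

  high : U → Bool
  high u = k ≤ᵇ deg u

  record Stage (s : ℕ) : Set where
    field
      chosen      : Fin v → Bool
      alive       : U → Bool
      chosen-size : size chosen ≡ s
      complete    : ∀ u w → alive u ≡ true → chosen w ≡ true → R u w ≡ true
      alive-high  : ∀ u → alive u ≡ true → k ≤ deg u
      alive-many  : count E high * (k ∸ t) ^ s ≤ v ^ s * count E alive

  initial : Stage 0
  initial = record
    { chosen = λ _ → false ; alive = high ; chosen-size = sumFin-const v 0
    ; complete = λ u w _ ()
    ; alive-high = λ u hu → ≤ᵇ⇒≤ k (deg u) (Equivalence.from T-≡ hu)
    ; alive-many = ≤-reflexive (trans (*-identityʳ _) (sym (+-identityʳ _))) }

  -- Double counting at a stage s < t: each survivor has ≥ k − t neighbours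
  -- outside T, so the survivors send ≥ |G| (k − t) edges to Fin v ∖ T.
  module _ {s} (s<t : s < t) (st : Stage s) where
    open Stage st

    hits : Fin v → ℕ
    hits x = count E (λ u → alive u ∧ R u x)

    freshDegree : ∀ u → ⟦ alive u ⟧ * (k ∸ t) ≤ sumFin v (λ x → ⟦ not (chosen x) ⟧ * ⟦ alive u ∧ R u x ⟧)
    freshDegree u with alive u in au
    ... | false = z≤n
    ... | true  = begin
      1 * (k ∸ t) ≡⟨ *-identityˡ _ ⟩
      k ∸ t       ≤⟨ ∸-mono (alive-high u au) (<⇒≤ s<t) ⟩
      deg u ∸ s   ≤⟨ m≤n+o⇒m∸n≤o (deg u) s (≤-trans (size-split v chosen (R u))
                       (≤-reflexive (trans (+-comm _ (size chosen)) (cong (_+ _) chosen-size)))) ⟩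
      sumFin v (λ x → ⟦ not (chosen x) ⟧ * ⟦ R u x ⟧) ∎

    survivorEdges : count E alive * (k ∸ t) ≤ sumFin v (λ x → ⟦ not (chosen x) ⟧ * hits x)
    survivorEdges = begin
      count E alive * (k ∸ t)                                              ≡⟨ sum-*ʳ E _ _ ⟨
      sum E (λ u → ⟦ alive u ⟧ * (k ∸ t))                                  ≤⟨ sum-mono E _ _ freshDegree ⟩
      sum E (λ u → sumFin v (λ x → ⟦ not (chosen x) ⟧ * ⟦ alive u ∧ R u x ⟧)) ≡⟨ sum-swap E v _ ⟩
      sumFin v (λ x → sum E (λ u → ⟦ not (chosen x) ⟧ * ⟦ alive u ∧ R u x ⟧))
        ≡⟨ sum-cong (finSum v) _ _ (λ x → sum-*ˡ E ⟦ not (chosen x) ⟧ _) ⟩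
      sumFin v (λ x → ⟦ not (chosen x) ⟧ * hits x)                         ∎

  extend : ∀ s → s < t → Stage s → Stage (suc s)
  extend s s<t st = record
    { chosen = chosen′ ; alive = alive′ ; chosen-size = trans (size-insert v chosen w w∉T) (cong suc chosen-size)
    ; complete = complete′ ; alive-high = λ u a′u → alive-high u (∧-conicalˡ (alive u) (R u w) a′u)
    ; alive-many = alive-many′ }
    where
    open Stage st
    best = bestOutside v chosen (hits s<t st)
             (nonMember v chosen (subst (_< v) (sym chosen-size) (≤-trans s<t t≤v)))
    w = proj₁ best
    w∉T = proj₁ (proj₂ best)
    chosen′ : Fin v → Bool
    chosen′ x = chosen x ∨ (x == w)
    alive′ : U → Bool
    alive′ u = alive u ∧ R u w
    complete′ : ∀ u x → alive′ u ≡ true → chosen′ x ≡ true → R u x ≡ true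
    complete′ u x a′u T′x with chosen x in Tx
    ... | true  = complete u x (∧-conicalˡ (alive u) (R u w) a′u) Tx
    ... | false rewrite ==-sound x w T′x = ∧-conicalʳ (alive u) (R u w) a′u
    alive-many′ : count E high * (k ∸ t) ^ suc s ≤ v ^ suc s * count E alive′
    alive-many′ = begin
      h * ((k ∸ t) * (k ∸ t) ^ s)       ≡⟨ rearrange₁ h (k ∸ t) _ ⟩
      (h * (k ∸ t) ^ s) * (k ∸ t)       ≤⟨ *-monoˡ-≤ (k ∸ t) alive-many ⟩
      (v ^ s * count E alive) * (k ∸ t) ≡⟨ *-assoc (v ^ s) _ _ ⟩
      v ^ s * (count E alive * (k ∸ t)) ≤⟨ *-monoʳ-≤ (v ^ s) (≤-trans (survivorEdges s<t st) (proj₂ (proj₂ best))) ⟩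
      v ^ s * (v * count E alive′)      ≡⟨ rearrange₂ (v ^ s) v _ ⟩
      (v * v ^ s) * count E alive′      ∎
      where
      h = count E high
      rearrange₁ : ∀ a b c → a * (b * c) ≡ (a * c) * b
      rearrange₁ = solve-∀
      rearrange₂ : ∀ a b c → a * (b * c) ≡ (b * a) * c
      rearrange₂ = solve-∀

  run : ∀ s → s ≤ t → Stage s
  run zero    _   = initial
  run (suc s) s<t = extend s s<t (run s (<⇒≤ s<t))

manyLarge : ∀ {U} (E : Summation U) (f : U → ℕ) (v ρ k : ℕ) → .{{NonZero v}} →
  (∀ u → f u ≤ v) → k * (2 * ρ) ≤ v → v * card E ≤ ρ * sum E f →
  card E ≤ 2 * ρ * count E (λ u → k ≤ᵇ f u)
manyLarge E f v ρ k f≤v kd≤v average = *-cancelʳ-≤ (card E) (2 * ρ * h) v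
  (≤-trans (≤-reflexive (*-comm (card E) v)) (+-cancelʳ-≤ (v * card E) (v * card E) _ twice))
  where
  h = count E (λ u → k ≤ᵇ f u)
  split : ∀ u → f u ≤ ⟦ k ≤ᵇ f u ⟧ * v + k
  split u with k ≤? f u
  ... | yes k≤fu rewrite Equivalence.to T-≡ (≤⇒≤ᵇ k≤fu) =
    ≤-trans (f≤v u) (≤-trans (≤-reflexive (sym (+-identityʳ v))) (m≤m+n _ k))
  ... | no  k≰fu = ≤-trans (<⇒≤ (≰⇒> k≰fu)) (m≤n+m k _)
  total : sum E f ≤ h * v + k * card E
  total = ≤-trans (sum-mono E _ _ split)
    (≤-reflexive (trans (sum-+ E _ _) (cong₂ _+_ (sum-*ʳ E _ v) (sum-const E k))))
  twice : v * card E + v * card E ≤ 2 * ρ * h * v + v * card E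
  twice = begin
    v * card E + v * card E       ≡⟨ double (v * card E) ⟩
    2 * (v * card E)              ≤⟨ *-monoʳ-≤ 2 (≤-trans average (*-monoʳ-≤ ρ total)) ⟩
    2 * (ρ * (h * v + k * card E)) ≡⟨ expand ρ h v k (card E) ⟩
    2 * ρ * h * v + k * (2 * ρ) * card E ≤⟨ +-monoʳ-≤ _ (*-monoˡ-≤ (card E) kd≤v) ⟩
    2 * ρ * h * v + v * card E    ∎
    where
    double : ∀ x → x + x ≡ 2 * x
    double = solve-∀
    expand : ∀ ρ h v k c → 2 * (ρ * (h * v + k * c)) ≡ 2 * ρ * h * v + k * (2 * ρ) * c
    expand = solve-∀

-- The degree threshold k = ⌊v / 2ρ⌋.  When 4ρt ≤ v it satisfies k (2ρ) ≤ v,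
-- t ≤ k and v ≤ 8ρ(k − t), because v < 2ρ(k + 1) and k − t ≥ k/2 ≥ 1/2.
threshold : ∀ v ρ t → 1 ≤ ρ → 1 ≤ t → 4 * ρ * t ≤ v →
  Σ ℕ λ k → k * (2 * ρ) ≤ v × t ≤ k × v ≤ 8 * ρ * (k ∸ t)
threshold v ρ t ρ≥1 t≥1 4ρt≤v = k , kd≤v , t≤k , v≤8ρ[k-t]
  where
  d = 2 * ρ
  instance
    d≢0 : NonZero d
    d≢0 = >-nonZero (≤-trans ρ≥1 (m≤n*m ρ 2))
  k = v / d
  kd≤v : k * d ≤ v
  kd≤v = m/n*n≤m v d
  v<[k+1]d : v < suc k * d
  v<[k+1]d = begin-strict
    v             ≡⟨ m≡m%n+[m/n]*n v d ⟩
    v % d + k * d <⟨ +-monoˡ-< (k * d) (m%n<n v d) ⟩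
    d + k * d     ∎
  2t≤k : 2 * t ≤ k
  2t≤k = s≤s⁻¹ (*-cancelʳ-< d (2 * t) (suc k)
           (≤-trans (s≤s (≤-reflexive (rearrange t ρ))) (≤-trans (s≤s 4ρt≤v) v<[k+1]d)))
    where
    rearrange : ∀ t ρ → 2 * t * (2 * ρ) ≡ 4 * ρ * t
    rearrange = solve-∀
  t≤k : t ≤ k
  t≤k = ≤-trans (m≤m+n t _) 2t≤k
  k≤2[k-t] : k ≤ 2 * (k ∸ t)
  k≤2[k-t] = begin
    k                 ≡⟨ m∸n+n≡m t≤k ⟨
    (k ∸ t) + t       ≤⟨ +-monoʳ-≤ (k ∸ t) (m+n≤o⇒m≤o∸n t (subst (_≤ k) (cong (t +_) (+-identityʳ t)) 2t≤k)) ⟩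
    (k ∸ t) + (k ∸ t) ≡⟨ cong ((k ∸ t) +_) (sym (+-identityʳ (k ∸ t))) ⟩
    2 * (k ∸ t)       ∎
  v≤8ρ[k-t] : v ≤ 8 * ρ * (k ∸ t)
  v≤8ρ[k-t] = begin
    v                               ≤⟨ <⇒≤ v<[k+1]d ⟩
    suc k * d                       ≤⟨ *-monoˡ-≤ d (+-monoˡ-≤ k (≤-trans t≥1 t≤k)) ⟩
    (k + k) * d                     ≤⟨ *-monoˡ-≤ d (+-mono-≤ k≤2[k-t] k≤2[k-t]) ⟩
    (2 * (k ∸ t) + 2 * (k ∸ t)) * d ≡⟨ rearrange (k ∸ t) ρ ⟩
    8 * ρ * (k ∸ t)                 ∎
    where
    rearrange : ∀ x ρ → (2 * x + 2 * x) * (2 * ρ) ≡ 8 * ρ * x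
    rearrange = solve-∀

^-distribʳ-* : ∀ a b n → (a * b) ^ n ≡ a ^ n * b ^ n
^-distribʳ-* a b zero    = refl
^-distribʳ-* a b (suc n) = trans (cong (a * b *_) (^-distribʳ-* a b n)) (interchange a b (a ^ n) (b ^ n))
  where
  interchange : ∀ a b c e → a * b * (c * e) ≡ a * c * (b * e)
  interchange = solve-∀

commonNeighbourhood : ∀ {U} (E : Summation U) (v : ℕ) (R : U → Fin v → Bool) (ρ t : ℕ) →
  1 ≤ ρ → 1 ≤ t → 4 * ρ * t ≤ v → v * card E ≤ ρ * sum E (λ u → size (R u)) →
  Biclique E v R t (2 * ρ * (8 * ρ) ^ t)
commonNeighbourhood E v R ρ t ρ≥1 t≥1 4ρt≤v average with threshold v ρ t ρ≥1 t≥1 4ρt≤v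
... | k , k[2ρ]≤v , t≤k , v≤8ρ[k-t] = record
  { tips = chosen ; base = alive ; tips-size = chosen-size ; complete = complete
  ; large = begin
      card E                                  ≤⟨ manyLarge E deg v ρ k (λ u → size≤ v (R u)) k[2ρ]≤v average ⟩
      2 * ρ * count E high                    ≤⟨ *-monoʳ-≤ (2 * ρ) fewLost ⟩
      2 * ρ * ((8 * ρ) ^ t * count E alive)   ≡⟨ *-assoc (2 * ρ) _ _ ⟨
      2 * ρ * (8 * ρ) ^ t * count E alive     ∎ }
  where
  t≤v : t ≤ v
  t≤v = ≤-trans (m≤n*m t (4 * ρ) {{>-nonZero (≤-trans ρ≥1 (m≤n*m ρ 4))}}) 4ρt≤v
  instance
    v≢0 : NonZero v
    v≢0 = >-nonZero (≤-trans t≥1 t≤v)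
  open Greedy E v R k t t≤v
  open Stage (run t ≤-refl)
  fewLost : count E high ≤ (8 * ρ) ^ t * count E alive
  fewLost = *-cancelˡ-≤ (v ^ t) {{m^n≢0 v t}} (begin
    v ^ t * count E high                       ≤⟨ *-monoˡ-≤ _ (^-monoˡ-≤ t v≤8ρ[k-t]) ⟩
    (8 * ρ * (k ∸ t)) ^ t * count E high       ≡⟨ cong (_* count E high) (^-distribʳ-* (8 * ρ) (k ∸ t) t) ⟩
    (8 * ρ) ^ t * (k ∸ t) ^ t * count E high   ≡⟨ rearrange ((8 * ρ) ^ t) _ _ ⟩
    (8 * ρ) ^ t * (count E high * (k ∸ t) ^ t) ≤⟨ *-monoʳ-≤ ((8 * ρ) ^ t) alive-many ⟩
    (8 * ρ) ^ t * (v ^ t * count E alive)      ≡⟨ rearrange′ ((8 * ρ) ^ t) (v ^ t) _ ⟩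
    v ^ t * ((8 * ρ) ^ t * count E alive)      ∎)
    where
    rearrange : ∀ a b c → a * b * c ≡ a * (c * b)
    rearrange = solve-∀
    rearrange′ : ∀ a b c → a * (b * c) ≡ b * (a * c)
    rearrange′ = solve-∀

-- n < 2ⁿ, the source of all the slack in the size estimates.
n<2^n : ∀ n → n < 2 ^ n
n<2^n zero    = s≤s z≤n
n<2^n (suc n) = ≤-trans (+-mono-≤ (m^n>0 2 n) (n<2^n n)) (≤-reflexive (cong (2 ^ n +_) (sym (+-identityʳ (2 ^ n)))))

4*2^e*t≤2^[2+e+t] : ∀ e t → 4 * 2 ^ e * t ≤ 2 ^ (2 + e + t)
4*2^e*t≤2^[2+e+t] e t = begin
  4 * 2 ^ e * t       ≤⟨ *-monoʳ-≤ (4 * 2 ^ e) (<⇒≤ (n<2^n t)) ⟩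
  4 * 2 ^ e * 2 ^ t   ≡⟨ cong (_* 2 ^ t) (^-distribˡ-+-* 2 2 e) ⟨
  2 ^ (2 + e) * 2 ^ t ≡⟨ ^-distribˡ-+-* 2 (2 + e) t ⟨
  2 ^ (2 + e + t)     ∎

-- The exponent of the loss in the biclique lemma at density 2^{-e}.
loss : ℕ → ℕ → ℕ
loss e t = (e + 4) * (t + 1)

loss≤ : ∀ e t Y → 4 ≤ e → 2 * (t + 1) ≤ Y → loss e t ≤ e * Y
loss≤ e t Y 4≤e 2[t+1]≤Y = begin
  (e + 4) * (t + 1)  ≤⟨ *-monoˡ-≤ (t + 1) (+-monoʳ-≤ e 4≤e) ⟩
  (e + e) * (t + 1)  ≡⟨ rearrange e t ⟩
  e * (2 * (t + 1))  ≤⟨ *-monoʳ-≤ e 2[t+1]≤Y ⟩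
  e * Y              ∎
  where
  rearrange : ∀ e t → (e + e) * (t + 1) ≡ e * (2 * (t + 1))
  rearrange = solve-∀

commonNeighbourhood₂ : ∀ {U} (E : Summation U) (v : ℕ) (R : U → Fin v → Bool) (e t : ℕ) →
  1 ≤ t → 2 ^ (2 + e + t) ≤ v → v * card E ≤ 2 ^ e * sum E (λ u → size (R u)) →
  Biclique E v R t (2 ^ loss e t)
commonNeighbourhood₂ E v R e t t≥1 v-large average =
  weaken lossBound (commonNeighbourhood E v R (2 ^ e) t (m^n>0 2 e) t≥1 (≤-trans (4*2^e*t≤2^[2+e+t] e t) v-large) average)
  where
  lossBound : 2 * 2 ^ e * (8 * 2 ^ e) ^ t ≤ 2 ^ loss e t
  lossBound = begin
    2 * 2 ^ e * (8 * 2 ^ e) ^ t       ≡⟨ cong (λ x → 2 * 2 ^ e * x ^ t) (^-distribˡ-+-* 2 3 e) ⟨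
    2 * 2 ^ e * (2 ^ (3 + e)) ^ t     ≡⟨ cong (2 * 2 ^ e *_) (^-*-assoc 2 (3 + e) t) ⟩
    2 ^ (1 + e) * 2 ^ ((3 + e) * t)   ≡⟨ ^-distribˡ-+-* 2 (1 + e) _ ⟨
    2 ^ (1 + e + (3 + e) * t)         ≤⟨ ^-monoʳ-≤ 2 (m≤m+n (1 + e + (3 + e) * t) (3 + t)) ⟩
    2 ^ (1 + e + (3 + e) * t + (3 + t)) ≡⟨ cong (2 ^_) (expand e t) ⟩
    2 ^ loss e t                      ∎
    where
    expand : ∀ e t → 1 + e + (3 + e) * t + (3 + t) ≡ (e + 4) * (t + 1)
    expand = solve-∀

Graph : ℕ → ℕ → ℕ → Set
Graph a b z = Fin a → Fin b → Fin z → Fin z → Bool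

CompleteSubgraph : ∀ a b z → Graph a b z → ℕ → Set
CompleteSubgraph a b z E t =
  Σ (Subset a) λ A′ → Σ (Subset b) λ B′ → Σ (Subset z) λ Z₁ → Σ (Subset z) λ Z₂ →
    ∣ A′ ∣ ≡ t × ∣ B′ ∣ ≡ t × ∣ Z₁ ∣ ≡ t × ∣ Z₂ ∣ ≡ t ×
    (∀ i → i ∈ Z₁ → i ∉ Z₂) ×
    (∀ x y i j → x ∈ A′ → y ∈ B′ → i ∈ Z₁ → j ∈ Z₂ → E x y i j ≡ true)

toCompleteSubgraph : ∀ {a b z} (E : Graph a b z) t (A′ : Fin a → Bool) (B′ : Fin b → Bool) (Z₁ Z₂ : Fin z → Bool) →
  size A′ ≡ t → size B′ ≡ t → size Z₁ ≡ t → size Z₂ ≡ t →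
  (∀ i → Z₁ i ≡ true → Z₂ i ≡ true → ⊥) →
  (∀ x y i j → A′ x ≡ true → B′ y ≡ true → Z₁ i ≡ true → Z₂ j ≡ true → E x y i j ≡ true) →
  CompleteSubgraph a b z E t
toCompleteSubgraph {a} {b} {z} E t A′ B′ Z₁ Z₂ |A′| |B′| |Z₁| |Z₂| disjoint edge =
  toSubset A′ , toSubset B′ , toSubset Z₁ , toSubset Z₂ ,
  trans (∣toSubset∣ a A′) |A′| , trans (∣toSubset∣ b B′) |B′| ,
  trans (∣toSubset∣ z Z₁) |Z₁| , trans (∣toSubset∣ z Z₂) |Z₂| ,
  (λ i i∈Z₁ i∈Z₂ → disjoint i (∈-toSubset Z₁ i i∈Z₁) (∈-toSubset Z₂ i i∈Z₂)) ,
  (λ x y i j x∈A′ y∈B′ i∈Z₁ j∈Z₂ →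
    edge x y i j (∈-toSubset A′ x x∈A′) (∈-toSubset B′ y y∈B′) (∈-toSubset Z₁ i i∈Z₁) (∈-toSubset Z₂ j j∈Z₂))

emptySubgraph : ∀ a b z (E : Graph a b z) → CompleteSubgraph a b z E 0
emptySubgraph a b z E =
  toCompleteSubgraph E 0 none none none none
    (sumFin-const a 0) (sumFin-const b 0) (sumFin-const z 0) (sumFin-const z 0) (λ i ()) (λ x y i j ())
  where
  none : ∀ {n} → Fin n → Bool
  none _ = false

Triples : ∀ b z → Summation (Fin b × (Fin z × Fin z))
Triples b z = finSum b ⊗ (finSum z ⊗ finSum z)

link : ∀ {a b z} → Graph a b z → Fin b × (Fin z × Fin z) → Fin a → Bool
link E (y , i , j) x = E x y i j

edgeCount≤ : ∀ a b z (E : Graph a b z) → edgeCount a b z E ≤ sum (Triples b z) (λ u → size (link E u))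
edgeCount≤ a b z E = begin
  edgeCount a b z E                                     ≤⟨ sumFin-mono a _ _ (λ x → sumFin-mono b _ _ (λ y →
                          sumFin-mono z _ _ (λ i → sumFin-mono z _ _ (λ j → ordered _ (E x y i j))))) ⟩
  sumFin a (λ x → sum (Triples b z) (λ u → ⟦ link E u x ⟧)) ≡⟨ sum-swap (Triples b z) a _ ⟨
  sum (Triples b z) (λ u → size (link E u))              ∎
  where
  ordered : ∀ c e → (if c ∧ e then 1 else 0) ≤ ⟦ e ⟧
  ordered true  true  = ≤-refl
  ordered true  false = z≤n
  ordered false e     = z≤n

2*nC2 : ∀ n → 2 * (n C 2) ≡ n * (n ∸ 1)
2*nC2 zero          = refl
2*nC2 (suc zero)    = refl
2*nC2 (suc (suc n)) = begin-equality
  2 * (suc (suc n) C 2)        ≡⟨ cong (2 *_) (nCk+nC[k+1]≡[n+1]C[k+1] (suc n) 1) ⟨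
  2 * (suc n C 1 + suc n C 2)  ≡⟨ cong (λ x → 2 * (x + suc n C 2)) (nC1≡n (suc n)) ⟩
  2 * (suc n + suc n C 2)      ≡⟨ *-distribˡ-+ 2 (suc n) _ ⟩
  2 * suc n + 2 * (suc n C 2)  ≡⟨ cong (2 * suc n +_) (2*nC2 (suc n)) ⟩
  2 * suc n + suc n * n        ≡⟨ expand n ⟩
  suc (suc n) * suc n          ∎
  where
  expand : ∀ n → 2 * suc n + suc n * n ≡ suc (suc n) * suc n
  expand = solve-∀

n²≤4*nC2 : ∀ n → 2 ≤ n → n * n ≤ 2 * (2 * (n C 2))
n²≤4*nC2 (suc zero)    (s≤s ())
n²≤4*nC2 (suc (suc n)) _ = begin
  suc (suc n) * suc (suc n)       ≤⟨ *-monoʳ-≤ (suc (suc n)) (m≤m+n (suc (suc n)) n) ⟩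
  suc (suc n) * (suc (suc n) + n) ≡⟨ expand n ⟩
  2 * (suc (suc n) * suc n)       ≡⟨ cong (2 *_) (2*nC2 (suc (suc n))) ⟨
  2 * (2 * (suc (suc n) C 2))     ∎
  where
  expand : ∀ n → suc (suc n) * (suc (suc n) + n) ≡ 2 * (suc (suc n) * suc n)
  expand = solve-∀

tripleDensity : ∀ a b z (E : Graph a b z) g r → 2 ≤ z → 2 * r ≤ 2 ^ g →
  2 * (a * b * (z C 2)) ≤ r * edgeCount a b z E →
  a * card (Triples b z) ≤ 2 ^ g * sum (Triples b z) (λ u → size (link E u))
tripleDensity a b z E g r z≥2 2r≤2^g dense = begin
  a * (b * (z * z))                           ≤⟨ *-monoʳ-≤ a (*-monoʳ-≤ b (n²≤4*nC2 z z≥2)) ⟩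
  a * (b * (2 * (2 * (z C 2))))               ≡⟨ rearrange a b (z C 2) ⟩
  2 * (2 * (a * b * (z C 2)))                 ≤⟨ *-monoʳ-≤ 2 dense ⟩
  2 * (r * edgeCount a b z E)                 ≤⟨ *-monoʳ-≤ 2 (*-monoʳ-≤ r (edgeCount≤ a b z E)) ⟩
  2 * (r * sum (Triples b z) (λ u → size (link E u))) ≡⟨ *-assoc 2 r _ ⟨
  2 * r * sum (Triples b z) (λ u → size (link E u))   ≤⟨ *-monoˡ-≤ _ 2r≤2^g ⟩
  2 ^ g * sum (Triples b z) (λ u → size (link E u))   ∎
  where
  rearrange : ∀ a b c → a * (b * (2 * (2 * c))) ≡ 2 * (2 * (a * b * c))
  rearrange = solve-∀

-- With Y = loss g t, density ≥ 2/r ≥ 2^{2-g} and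
-- |A|, |B| ≥ 2^{Y+t+2}, |Z| ≥ 2^{Y³+t+2}, three applications of the biclique
-- lemma (densities 2^{-g}, 2^{-Y}, 2^{-Y²}, losses 2^Y, 2^{Y²}, 2^{Y³})
-- produce A′, B′, Z₂ and ≥ t common neighbours i ∈ Z, from which Z₁ is chosen.
completeSubgraph : ∀ a b z (E : Graph a b z) → (∀ x y i → E x y i i ≡ false) →
  ∀ g r t → 1 ≤ t → 2 * r ≤ 2 ^ g →
  2 ^ (2 + loss g t + t) ≤ a → 2 ^ (2 + loss g t + t) ≤ b →
  2 ^ (2 + loss g t * loss g t * loss g t + t) ≤ z →
  2 * (a * b * (z C 2)) ≤ r * edgeCount a b z E → CompleteSubgraph a b z E t
completeSubgraph a b z E no-loops g r t t≥1 2r≤2^g a-large b-large z-large dense =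
  toCompleteSubgraph E t A′ B′ Z₁ Z₂ |A′| |B′| |Z₁| |Z₂| disjoint edge
  where
  Y = loss g t
  instance
    t+1≢0 : NonZero (t + 1)
    t+1≢0 = >-nonZero (m≤n+m 1 t)
  g≤Y : g ≤ Y
  g≤Y = ≤-trans (m≤m+n g 4) (m≤m*n (g + 4) (t + 1))
  4≤Y : 4 ≤ Y
  4≤Y = ≤-trans (m≤n+m 4 g) (m≤m*n (g + 4) (t + 1))
  2[t+1]≤Y : 2 * (t + 1) ≤ Y
  2[t+1]≤Y = *-monoˡ-≤ (t + 1) (≤-trans (s≤s (s≤s z≤n)) (m≤n+m 4 g))
  instance
    Y≢0 : NonZero Y
    Y≢0 = >-nonZero (≤-trans (s≤s z≤n) 4≤Y)
  stageA : Biclique (Triples b z) a (link E) t (2 ^ Y)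
  stageA = commonNeighbourhood₂ (Triples b z) a (link E) g t t≥1
    (≤-trans (^-monoʳ-≤ 2 (+-monoˡ-≤ t (+-monoʳ-≤ 2 g≤Y))) a-large)
    (tripleDensity a b z E g r (≤-trans (^-monoʳ-≤ 2 {1} {2 + Y * Y * Y + t} (s≤s z≤n)) z-large) 2r≤2^g dense)
  open Biclique stageA renaming (tips to A′; base to Ga; tips-size to |A′|; complete to completeA)
  -- B against the pairs (i, j) with (y, i, j) surviving: density 2^{-Y}, loss 2^{Y²}
  Rb : Fin z × Fin z → Fin b → Bool
  Rb p y = Ga (y , p)
  stageB : Biclique (finSum z ⊗ finSum z) b Rb t (2 ^ (Y * Y))
  stageB = weaken (^-monoʳ-≤ 2 (loss≤ Y t Y 4≤Y 2[t+1]≤Y))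
    (commonNeighbourhood₂ (finSum z ⊗ finSum z) b Rb Y t t≥1 b-large
      (≤-trans (Biclique.large stageA)
        (≤-reflexive (cong (2 ^ Y *_) (sym (sum-swap (finSum z ⊗ finSum z) b (λ p y → ⟦ Rb p y ⟧)))))))
  open Biclique stageB renaming (tips to B′; base to Gb; tips-size to |B′|; complete to completeB)
  -- j ∈ Z against i ∈ Z with (i, j) surviving: density 2^{-Y²}, loss 2^{Y³}
  stageC : Biclique (finSum z) z (λ i j → Gb (i , j)) t (2 ^ (Y * Y * Y))
  stageC = weaken (^-monoʳ-≤ 2 (loss≤ (Y * Y) t Y (≤-trans 4≤Y (m≤m*n Y Y)) 2[t+1]≤Y))
    (commonNeighbourhood₂ (finSum z) z (λ i j → Gb (i , j)) (Y * Y) t t≥1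
      (≤-trans (^-monoʳ-≤ 2 (+-monoˡ-≤ t (+-monoʳ-≤ 2 (m≤m*n (Y * Y) Y)))) z-large) (Biclique.large stageB))
  open Biclique stageC renaming (tips to Z₂; base to Gc; tips-size to |Z₂|; complete to completeC)
  -- the common neighbourhood Gc of Z₂ has ≥ t elements since t 2^{Y³} ≤ |Z|
  t≤|Gc| : t ≤ size Gc
  t≤|Gc| = *-cancelˡ-≤ (2 ^ (Y * Y * Y)) {{m^n≢0 2 (Y * Y * Y)}} (begin
    2 ^ (Y * Y * Y) * t       ≤⟨ *-monoˡ-≤ t (m≤n*m (2 ^ (Y * Y * Y)) 4) ⟩
    4 * 2 ^ (Y * Y * Y) * t   ≤⟨ 4*2^e*t≤2^[2+e+t] (Y * Y * Y) t ⟩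
    2 ^ (2 + Y * Y * Y + t)   ≤⟨ z-large ⟩
    z                         ≤⟨ Biclique.large stageC ⟩
    2 ^ (Y * Y * Y) * size Gc ∎)
  Z₁ = proj₁ (choose z Gc t t≤|Gc|)
  |Z₁| = proj₁ (proj₂ (choose z Gc t t≤|Gc|))
  Z₁⊆Gc = proj₂ (proj₂ (choose z Gc t t≤|Gc|))
  edge : ∀ x y i j → A′ x ≡ true → B′ y ≡ true → Z₁ i ≡ true → Z₂ j ≡ true → E x y i j ≡ true
  edge x y i j x∈A′ y∈B′ i∈Z₁ j∈Z₂ =
    completeA (y , i , j) x (completeB (i , j) y (completeC i j (Z₁⊆Gc i i∈Z₁) j∈Z₂) y∈B′) x∈A′
  -- a common vertex i ∈ Z₁ ∩ Z₂ would give an edge {x, y, i, i}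
  disjoint : ∀ i → Z₁ i ≡ true → Z₂ i ≡ true → ⊥
  disjoint i i∈Z₁ i∈Z₂ = false≢true (trans (sym (no-loops x y i)) (edge x y i i x∈A′ y∈B′ i∈Z₁ i∈Z₂))
    where
    x = proj₁ (member a A′ (≤-trans t≥1 (≤-reflexive (sym |A′|))))
    x∈A′ = proj₂ (member a A′ (≤-trans t≥1 (≤-reflexive (sym |A′|))))
    y = proj₁ (member b B′ (≤-trans t≥1 (≤-reflexive (sym |B′|))))
    y∈B′ = proj₂ (member b B′ (≤-trans t≥1 (≤-reflexive (sym |B′|))))
    false≢true : false ≡ true → ⊥
    false≢true ()

-- If 2^{n+s} ≤ m ≤ s x then 2^n ≤ x, because s < 2^s.
powerBelow : ∀ n s m x → 2 ^ (n + s) ≤ m → m ≤ s * x → 2 ^ n ≤ x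
powerBelow n s m x 2^[n+s]≤m m≤sx = *-cancelʳ-≤ (2 ^ n) x (2 ^ s) {{m^n≢0 2 s}} (begin
  2 ^ n * 2 ^ s ≡⟨ ^-distribˡ-+-* 2 n s ⟨
  2 ^ (n + s)   ≤⟨ 2^[n+s]≤m ⟩
  m             ≤⟨ m≤sx ⟩
  s * x         ≤⟨ *-monoˡ-≤ x (<⇒≤ (n<2^n s)) ⟩
  2 ^ s * x     ≡⟨ *-comm (2 ^ s) x ⟩
  x * 2 ^ s     ∎)

-- Used to absorb the additive constant c into the cube (Y + c)³.
n≤n³ : ∀ n → n ≤ n * n * n
n≤n³ zero      = z≤n
n≤n³ n@(suc _) = ≤-trans (m≤m*n n n) (m≤m*n (n * n) n)

cubeBound : ∀ Y c m → Y + c ≤ m → Y * Y * Y + c ≤ m ^ 3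
cubeBound Y c m Y+c≤m = begin
  Y * Y * Y + c                    ≤⟨ +-monoʳ-≤ (Y * Y * Y) (n≤n³ c) ⟩
  Y * Y * Y + c * c * c            ≤⟨ m≤m+n (Y * Y * Y + c * c * c) (3 * (Y * Y * c) + 3 * (Y * c * c)) ⟩
  Y * Y * Y + c * c * c + (3 * (Y * Y * c) + 3 * (Y * c * c)) ≡⟨ cube Y c ⟨
  (Y + c) * (Y + c) * (Y + c)      ≤⟨ *-mono-≤ (*-mono-≤ Y+c≤m Y+c≤m) Y+c≤m ⟩
  m * m * m                        ≡⟨ cubed m ⟩
  m ^ 3                            ∎
  where
  cube : ∀ Y c → (Y + c) * (Y + c) * (Y + c) ≡ Y * Y * Y + c * c * c + (3 * (Y * Y * c) + 3 * (Y * c * c))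
  cube = solve-∀
  cubed : ∀ m → m * m * m ≡ m * (m * (m * 1))
  cubed = solve-∀

-- The constant of the theorem: t ≤ (1/q) log₂ m is small enough, where q
-- depends on the scales s₁, s₂ of |A|, |B|, |Z| and on the density 2/r.
exponent : ℕ → ℕ → ℕ → ℕ
exponent s₁ s₂ r = 2 * (suc r + 4) + 3 + s₁ + s₂

-- The theorem with the rational constants cleared: m ≤ s₁|A|, m ≤ s₁|B|,
-- 2^{m³} ≤ s₂|Z|, d₄(A, B, (Z choose 2)) ≥ 2/r and 2^{tq} ≤ m.
theoremℕ : ∀ s₁ s₂ r m a b z (E : Graph a b z) → (∀ x y i → E x y i i ≡ false) →
  m ≤ s₁ * a → m ≤ s₁ * b → 2 ^ (m ^ 3) ≤ s₂ * z →
  2 * (a * b * (z C 2)) ≤ r * edgeCount a b z E →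
  ∀ t → 2 ^ (t * exponent s₁ s₂ r) ≤ m → CompleteSubgraph a b z E t
theoremℕ s₁ s₂ r m a b z E no-loops m≤s₁a m≤s₁b 2^m³≤s₂z dense zero _ = emptySubgraph a b z E
theoremℕ s₁ s₂ r m a b z E no-loops m≤s₁a m≤s₁b 2^m³≤s₂z dense t@(suc t′) 2^W≤m =
  completeSubgraph a b z E no-loops g r t (s≤s z≤n) (*-monoʳ-≤ 2 (<⇒≤ (n<2^n r)))
    (powerBelow (2 + Y + t) s₁ m a 2^[2+Y+t+s₁]≤m m≤s₁a)
    (powerBelow (2 + Y + t) s₁ m b 2^[2+Y+t+s₁]≤m m≤s₁b)
    (powerBelow (2 + Y * Y * Y + t) s₂ (2 ^ (m ^ 3)) z (^-monoʳ-≤ 2 budgetZ) 2^m³≤s₂z)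
    dense
  where
  g = suc r
  Y = loss g t
  W = t * exponent s₁ s₂ r
  -- W exceeds the exponents needed for A, B and Z (using t ≥ 1)
  slackA : ∀ g s₁ s₂ t′ → 2 + (g + 4) * (suc t′ + 1) + suc t′ + s₁ + ((g + 4) * t′ + 2 * t′ + s₁ * t′ + s₂ * suc t′)
                          ≡ suc t′ * (2 * (g + 4) + 3 + s₁ + s₂)
  slackA = solve-∀
  slackZ : ∀ g s₁ s₂ t′ → (g + 4) * (suc t′ + 1) + (2 + suc t′ + s₂) + ((g + 4) * t′ + 2 * t′ + s₁ * suc t′ + s₂ * t′)
                          ≡ suc t′ * (2 * (g + 4) + 3 + s₁ + s₂)
  slackZ = solve-∀
  2^[2+Y+t+s₁]≤m : 2 ^ (2 + Y + t + s₁) ≤ m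
  2^[2+Y+t+s₁]≤m = ≤-trans (^-monoʳ-≤ 2 (≤-trans (m≤m+n (2 + Y + t + s₁) _) (≤-reflexive (slackA g s₁ s₂ t′)))) 2^W≤m
  budgetZ : 2 + Y * Y * Y + t + s₂ ≤ m ^ 3
  budgetZ = subst (_≤ m ^ 3) (rearrange (Y * Y * Y) t s₂)
    (cubeBound Y (2 + t + s₂) m (≤-trans (≤-trans (m≤m+n (Y + (2 + t + s₂)) _) (≤-reflexive (slackZ g s₁ s₂ t′)))
                                          (≤-trans (<⇒≤ (n<2^n W)) 2^W≤m)))
    where
    rearrange : ∀ Y³ t s → Y³ + (2 + t + s) ≡ 2 + Y³ + t + s
    rearrange = solve-∀

-- Clear the denominators of c₁, c₂, η and apply `theoremℕ` with p = 1.
lemma3 : (c₁ c₂ η : ℚ) → 0ℚ <ℚ c₁ → c₁ <ℚ 1ℚ → 0ℚ <ℚ c₂ → c₂ <ℚ 1ℚ → 0ℚ <ℚ η →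
    ∃[ p ] ∃[ q ] (0 < p × 0 < q ×
    ((m : ℕ) → 0 < m →
    (a b z : ℕ) →
    ℕtoℚ a ≡ c₁ *ℚ ℕtoℚ m → ℕtoℚ b ≡ c₁ *ℚ ℕtoℚ m →
    ℕtoℚ z ≡ c₂ *ℚ ℕtoℚ (2 ^ (m ^ 3)) →
    (E : Fin a → Fin b → Fin z → Fin z → Bool) →
    (∀ x y i j → E x y i j ≡ E x y j i) →
    (∀ x y i → E x y i i ≡ false) →
    (ℕtoℚ 2 *ℚ η) *ℚ ℕtoℚ (a * b * (z C 2)) ≤ℚ ℕtoℚ (edgeCount a b z E) →
    (t : ℕ) → 2 ^ (t * q) ≤ m ^ p →
    Σ (Subset a) λ A′ → Σ (Subset b) λ B′ → Σ (Subset z) λ Z₁ → Σ (Subset z) λ Z₂ →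
    ∣ A′ ∣ ≡ t × ∣ B′ ∣ ≡ t × ∣ Z₁ ∣ ≡ t × ∣ Z₂ ∣ ≡ t ×
    (∀ i → i ∈ Z₁ → i ∉ Z₂) ×
    (∀ x y i j → x ∈ A′ → y ∈ B′ → i ∈ Z₁ → j ∈ Z₂ → E x y i j ≡ true)))
lemma3 c₁ c₂ η c₁>0 _ c₂>0 _ η>0 = 1 , exponent s₁ s₂ r , s≤s z≤n , s≤s z≤n ,
  λ m _ a b z a≡c₁m b≡c₁m z≡c₂2^m³ E _ no-loops dense t 2^tq≤m →
    theoremℕ s₁ s₂ r m a b z E no-loops
      (ratioBound C₁ a m a≡c₁m) (ratioBound C₁ b m b≡c₁m) (ratioBound C₂ z (2 ^ (m ^ 3)) z≡c₂2^m³)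
      (densityBound Cη (a * b * (z C 2)) (edgeCount a b z E) dense)
      t (≤-trans 2^tq≤m (≤-reflexive (*-identityʳ m)))
  where
  C₁ = clearDenominator c₁ c₁>0
  C₂ = clearDenominator c₂ c₂>0
  Cη = clearDenominator η η>0
  s₁ = suc (Cleared.den C₁)
  s₂ = suc (Cleared.den C₂)
  r  = suc (Cleared.den Cη)
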